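{- Let $G$ be a (finite, simple, connected) graph of order $n\ge 9$ with $\tau(G)\le n/2$ and diameter $\mathrm{diam}(G)=3$. Then $\beta_p(G)\le n-3$.
   Context: Two vertices $u,v$ are twins if $N(u)\setminus\{v\}=N(v)\setminus\{u\}$; twin classes are the equivalence classes of this relation and $\tau(G)$ is the maximum cardinality of a twin class. For $u$ a vertex and $S$ a vertex set, $d(u,S)=\min_{w\in S}d(u,w)$. A partition $\Pi=\{S_1,\dots,S_k\}$ of $V(G)$ is locating if the vectors $r(u|\Pi)=(d(u,S_1),\dots,d(u,S_k))$ are pairwise distinct over $u\in V(G)$; $\beta_p(G)$ is the minimum size of a locating partition. -}

module Defs where

open import Data.Nat using (ℕ; zero; suc; _<_; _≤_)
open import Data.Fin using (Fin)
open import Data.Fin.Subset using (Subset; _∈_; ∣_∣)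
open import Data.Bool using (Bool; true; false)
open import Data.Product using (Σ; _×_; ∃; ∃-syntax)
open import Relation.Binary.PropositionalEquality using (_≡_; _≢_)
open import Relation.Nullary using (¬_)
open import Function.Definitions using (Surjective)

record Graph (n : ℕ) : Set where
  field
    adj     : Fin n → Fin n → Bool
    adj-sym : ∀ u v → adj u v ≡ adj v u
    adj-irr : ∀ u → adj u u ≡ false
open Graph public

data Walk {n : ℕ} (G : Graph n) : Fin n → Fin n → ℕ → Set where
  here : ∀ {u} → Walk G u u 0
  step : ∀ {u w v k} → adj G u w ≡ true → Walk G w v k → Walk G u v (suc k)

Dist : ∀ {n} → Graph n → Fin n → Fin n → ℕ → Set
Dist G u v d = Walk G u v d × (∀ k → k < d → ¬ Walk G u v k)

Connected : ∀ {n} → Graph n → Set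
Connected G = ∀ u v → ∃[ d ] Walk G u v d

Diameter≡3 : ∀ {n} → Graph n → Set
Diameter≡3 G = (∀ u v → ∃[ d ] (d ≤ 3 × Walk G u v d))
             × (∃[ u ] ∃[ v ] Dist G u v 3)

Twins : ∀ {n} → Graph n → Fin n → Fin n → Set
Twins G u v = ∀ w → w ≢ u → w ≢ v → adj G u w ≡ adj G v w

-- τ(G) ≤ n/2 : every twin class (equivalently every set of pairwise twins)
-- has cardinality at most n/2, i.e. 2·|T| ≤ n.
TwinBound : ∀ {n} → Graph n → Set
TwinBound {n} G = (T : Subset n) →
  (∀ u v → u ∈ T → v ∈ T → Twins G u v) → ∣ T ∣ Data.Nat.+ ∣ T ∣ ≤ n

DistToClass : ∀ {n k} → Graph n → (Fin n → Fin k) → Fin n → Fin k → ℕ → Set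
DistToClass G f u i d =
  (∃[ w ] (f w ≡ i × Walk G u w d))
  × (∀ w → f w ≡ i → ∀ j → j < d → ¬ Walk G u w j)

-- A partition of V(G) into k (nonempty) classes, given by a surjective
-- class-assignment f, is locating if distinct vertices have distinct
-- distance vectors r(u|Π).
Locating : ∀ {n k} → Graph n → (Fin n → Fin k) → Set
Locating G f = ∀ u v → u ≢ v →
  ∃[ i ] ∃[ du ] ∃[ dv ]
    (DistToClass G f u i du × DistToClass G f v i dv × du ≢ dv)

PartitionDimAtMost : ∀ {n} → Graph n → ℕ → Set
PartitionDimAtMost {n} G m =
  ∃[ k ] (k ≤ m × Σ (Fin n → Fin k) λ f → Surjective _≡_ _≡_ f × Locating G f)

module Submission where

-- Fix a diametral path b₀ b₁ b₂ b₃, so that d(bᵢ,b₀) = i.  The n − 4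
-- vertices off the path cannot be pairwise twins, since n − 4 > n/2 ≥ τ(G)
-- when n ≥ 9; hence some vertex z is adjacent to exactly one of two off-path
-- vertices x, y.  A short case analysis on the position of z then produces a
-- configuration: a triple {a,b,c} whose members have pairwise distinct
-- distances to a vertex s, and a disjoint pair {p,q} with distinct distances
-- to a vertex t, where s and t lie outside both blocks.  The partition into
-- {a,b,c}, {p,q} and singletons has n − 3 classes and is locating: vertices
-- in different classes are told apart by the distance (zero) to their own
-- class, vertices in a common block by the singleton class {s} or {t}.

open import Defs
open import Data.Nat using (ℕ; zero; suc; _≤_; _<_; _∸_; _+_; z≤n; s≤s)
open import Data.Nat.Properties
  using (anyUpTo?; <-cmp; ≤-refl; ≤-trans; n≤1+n; +-cancelˡ-≤; +-monoˡ-≤; <⇒≱; module ≤-Reasoning)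
open import Data.Nat.Induction using (<-rec)
open import Data.Fin using (Fin; zero; suc; _≟_; punchIn; punchOut)
open import Data.Fin.Properties
  using (any?; suc-injective; punchOut-injective; punchOut-cong; punchOut-punchIn; punchInᵢ≢i)
open import Data.Fin.Subset using (Subset; _∈_; ∣_∣; ⊤; inside; outside; Nonempty)
open import Data.Fin.Subset.Properties using (_∈?_; ∣⊤∣≡n; ∣⊥∣≡0; nonempty?; Empty-unique)
open import Data.Vec.Base using (_∷_; here; there)
open import Data.Bool using (Bool; true; false)
open import Data.Bool.Properties using (¬-not) renaming (_≟_ to _≟ᵇ_)
open import Data.Product using (Σ-syntax; _×_; _,_; ∃-syntax)
open import Data.Sum using (_⊎_; inj₁; inj₂)
open import Data.Empty using (⊥; ⊥-elim)
open import Function using (_∘_)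
open import Function.Definitions using (Surjective)
import Function.Construct.Composition as Composition
open import Relation.Binary.PropositionalEquality
  using (_≡_; _≢_; refl; sym; trans; cong; subst; ≢-sym)
open import Relation.Binary.Definitions using (tri<; tri≈; tri>)
open import Relation.Nullary using (¬_; Dec; yes; no)
open import Relation.Nullary.Decidable using (_×-dec_; ¬?)

true≢false-values : ∀ {x y : Bool} → x ≡ true → y ≡ false → x ≢ y
true≢false-values refl refl ()

module _ {n : ℕ} (G : Graph n) where

  adj-flip : ∀ {u v} → adj G u v ≡ true → adj G v u ≡ true
  adj-flip {u} {v} e = trans (adj-sym G v u) e

  no-loop : ∀ {u} → adj G u u ≡ true → ⊥
  no-loop {u} e = true≢false-values e (adj-irr G u) refl

  snoc : ∀ {u v w k} → Walk G u v k → adj G v w ≡ true → Walk G u w (suc k)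
  snoc here e = step e here
  snoc (step e' r) e = step e' (snoc r e)

  reverse : ∀ {u v k} → Walk G u v k → Walk G v u k
  reverse here = here
  reverse (step e r) = snoc (reverse r) (adj-flip e)

  walk? : ∀ u v k → Dec (Walk G u v k)
  walk? u v zero with u ≟ v
  ... | yes refl = yes here
  ... | no u≢v = no λ { here → u≢v refl }
  walk? u v (suc k) with any? (λ w → (adj G u w ≟ᵇ true) ×-dec walk? w v k)
  ... | yes (w , e , r) = yes (step e r)
  ... | no none = no λ { (step {w = w} e r) → none (w , e , r) }

  walk-0 : ∀ {u v} → Walk G u v 0 → u ≡ v
  walk-0 here = refl

  walk-1 : ∀ {u v} → Walk G u v 1 → adj G u v ≡ true
  walk-1 (step e here) = e

  walk-2 : ∀ {u v} → Walk G u v 2 → ∃[ w ] (adj G u w ≡ true × adj G w v ≡ true)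
  walk-2 (step {w = w} e (step e' here)) = w , e , e'

  dist-unique : ∀ {u v d d'} → Dist G u v d → Dist G u v d' → d ≡ d'
  dist-unique {d = d} {d'} (w , shortest) (w' , shortest') with <-cmp d d'
  ... | tri< d<d' _ _ = ⊥-elim (shortest' d d<d' w)
  ... | tri≈ _ d≡d' _ = d≡d'
  ... | tri> _ _ d'<d = ⊥-elim (shortest d' d'<d w')

  dist-sym : ∀ {u v d} → Dist G u v d → Dist G v u d
  dist-sym (w , shortest) = reverse w , λ j j<d w' → shortest j j<d (reverse w')

  dist-1 : ∀ {u v} → u ≢ v → adj G u v ≡ true → Dist G u v 1
  dist-1 u≢v e = step e here , λ { zero _ w → u≢v (walk-0 w) ; (suc _) (s≤s ()) _ }

  dist-2 : ∀ {u v w} → u ≢ v → adj G u v ≡ false →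
    adj G u w ≡ true → adj G w v ≡ true → Dist G u v 2
  dist-2 {u} {v} u≢v u≁v e e' = step e (step e' here) , shorter
    where
    shorter : ∀ j → j < 2 → ¬ Walk G u v j
    shorter zero _ w = u≢v (walk-0 w)
    shorter (suc zero) _ w = true≢false-values (walk-1 w) u≁v refl
    shorter (suc (suc _)) (s≤s (s≤s ())) _

  nonadjacent⇒dist≢1 : ∀ {u v d} → adj G u v ≡ false → Dist G u v d → d ≢ 1
  nonadjacent⇒dist≢1 u≁v (w , _) refl = true≢false-values (walk-1 w) u≁v refl

  far⇒nonadjacent : ∀ {u v d} → Dist G u v (suc (suc d)) → adj G u v ≡ true → ⊥
  far⇒nonadjacent (_ , shortest) e = shortest 1 (s≤s (s≤s z≤n)) (step e here)

  Separates : Fin n → Fin n → Fin n → Set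
  Separates s u v = ∀ {d d'} → Dist G u s d → Dist G v s d' → d ≢ d'

  separates-sym : ∀ {s u v} → Separates s u v → Separates s v u
  separates-sym sep Dv Du d≡d' = sep Du Dv (sym d≡d')

  separates-by-distance : ∀ {s u v m m'} → Dist G u s m → Dist G v s m' → m ≢ m' →
    Separates s u v
  separates-by-distance Du Dv m≢m' Du' Dv' d≡d' =
    m≢m' (trans (dist-unique Du Du') (trans d≡d' (dist-unique Dv' Dv)))

  -- A vertex adjacent to exactly one of u, v separates them (distance 1 versus not 1).
  separates-by-adjacency : ∀ {s u v} → u ≢ s → v ≢ s → adj G u s ≢ adj G v s →
    Separates s u v
  separates-by-adjacency {s} {u} {v} u≢s v≢s different Du Dv
    with adj G u s in eu | adj G v s in ev
  ... | true  | true  = ⊥-elim (different refl)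
  ... | false | false = ⊥-elim (different refl)
  ... | true  | false = λ d≡d' →
    nonadjacent⇒dist≢1 ev Dv (trans (sym d≡d') (dist-unique Du (dist-1 u≢s eu)))
  ... | false | true  = λ d≡d' →
    nonadjacent⇒dist≢1 eu Du (trans d≡d' (dist-unique Dv (dist-1 v≢s ev)))

least-witness : ∀ {p} {P : ℕ → Set p} → (∀ m → Dec (P m)) →
  ∀ m → P m → ∃[ d ] (P d × (∀ j → j < d → ¬ P j))
least-witness {P = P} P? = <-rec (λ m → P m → ∃[ d ] (P d × (∀ j → j < d → ¬ P j))) search
  where
  search : ∀ m → (∀ {j} → j < m → P j → ∃[ d ] (P d × (∀ i → i < d → ¬ P i))) →
    P m → ∃[ d ] (P d × (∀ j → j < d → ¬ P j))
  search m smaller pm with anyUpTo? P? m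
  ... | yes (j , j<m , pj) = smaller j<m pj
  ... | no none = m , pm , λ j j<m pj → none (j , j<m , pj)

module _ {n k : ℕ} (G : Graph n) (f : Fin n → Fin k) where

  distToClass-exists : Connected G → ∀ u w → ∃[ d ] DistToClass G f u (f w) d
  distToClass-exists conn u w with conn u w
  ... | m , walk with least-witness (λ j → any? (λ w' → (f w' ≟ f w) ×-dec walk? G u w' j))
                        m (w , refl , walk)
  ... | d , reached , shortest =
    d , reached , λ w' fw' j j<d walk' → shortest j j<d (w' , fw' , walk')

  distToClass-own : ∀ u → DistToClass G f u (f u) 0
  distToClass-own u = (u , refl , here) , λ _ _ _ ()

  distToClass-other : ∀ {u v d} → f u ≢ f v → DistToClass G f v (f u) d → d ≢ 0
  distToClass-other fu≢fv ((w , fw , walk) , _) refl with walk-0 G walk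
  ... | refl = fu≢fv (sym fw)

  Singleton : Fin n → Set
  Singleton s = ∀ w → f w ≡ f s → w ≡ s

  distToClass-singleton : ∀ {s u d} → Singleton s → DistToClass G f u (f s) d → Dist G u s d
  distToClass-singleton single ((w , fw , walk) , shortest) with single w fw
  ... | refl = walk , λ j j<d walk' → shortest w fw j j<d walk'

  locating-criterion : Connected G →
    (∀ u v → u ≢ v → f u ≡ f v → ∃[ s ] (Singleton s × Separates G s u v)) →
    Locating G f
  locating-criterion conn split u v u≢v with f u ≟ f v
  ... | no fu≢fv with distToClass-exists conn v u
  ...   | dv , Dv = f u , 0 , dv , distToClass-own u , Dv ,
                    λ 0≡dv → distToClass-other fu≢fv Dv (sym 0≡dv)
  locating-criterion conn split u v u≢v | yes fu≡fv with split u v u≢v fu≡fv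
  ... | s , single , sep with distToClass-exists conn u s | distToClass-exists conn v s
  ...   | du , Du | dv , Dv = f s , du , dv , Du , Dv ,
          sep (distToClass-singleton single Du) (distToClass-singleton single Dv)

-- Distances exist in a connected graph (the partition into singletons).
dist-exists : ∀ {n} (G : Graph n) → Connected G → ∀ u v → ∃[ d ] Dist G u v d
dist-exists G conn u v with distToClass-exists G (λ w → w) conn u v
... | d , D = d , distToClass-singleton G (λ w → w) (λ _ w≡v → w≡v) D

separates⇒distinct : ∀ {n} (G : Graph n) → Connected G →
  ∀ {s u v} → Separates G s u v → u ≢ v
separates⇒distinct G conn {s} {u} sep refl with dist-exists G conn u s
... | d , D = sep D D refl

Pair : ∀ {n} → Fin n → Fin n → Fin n → Set
Pair p q u = u ≡ p ⊎ u ≡ q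

Triple : ∀ {n} → Fin n → Fin n → Fin n → Fin n → Set
Triple a b c u = Pair a b u ⊎ u ≡ c

not-pair : ∀ {n} {p q u : Fin n} → u ≢ p → u ≢ q → ¬ Pair p q u
not-pair u≢p _ (inj₁ u≡p) = u≢p u≡p
not-pair _ u≢q (inj₂ u≡q) = u≢q u≡q

not-triple : ∀ {n} {a b c u : Fin n} → u ≢ a → u ≢ b → u ≢ c → ¬ Triple a b c u
not-triple u≢a u≢b _ (inj₁ ab) = not-pair u≢a u≢b ab
not-triple _ _ u≢c (inj₂ u≡c) = u≢c u≡c

merge : ∀ {m} (x y : Fin (suc m)) → x ≢ y → Fin (suc m) → Fin m
merge x y x≢y v with v ≟ x
... | yes _ = punchOut x≢y
... | no v≢x = punchOut (v≢x ∘ sym)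

merge-surjective : ∀ {m} (x y : Fin (suc m)) (x≢y : x ≢ y) →
  Surjective _≡_ _≡_ (merge x y x≢y)
merge-surjective x y x≢y j = punchIn x j , λ { refl → hit }
  where
  hit : merge x y x≢y (punchIn x j) ≡ j
  hit with punchIn x j ≟ x
  ... | yes p = ⊥-elim (punchInᵢ≢i x j p)
  ... | no _ = trans (punchOut-cong x refl) (punchOut-punchIn x)

merge-kernel : ∀ {m} (x y : Fin (suc m)) (x≢y : x ≢ y) u v →
  merge x y x≢y u ≡ merge x y x≢y v → u ≡ v ⊎ (Pair x y u × Pair x y v)
merge-kernel x y x≢y u v eq with u ≟ x | v ≟ x
... | yes u≡x | yes v≡x = inj₁ (trans u≡x (sym v≡x))
... | yes u≡x | no v≢x = inj₂ (inj₁ u≡x , inj₂ (sym (punchOut-injective x≢y _ eq)))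
... | no u≢x | yes v≡x = inj₂ (inj₂ (punchOut-injective _ x≢y eq) , inj₁ v≡x)
... | no u≢x | no v≢x = inj₁ (punchOut-injective {i = x} (u≢x ∘ sym) (v≢x ∘ sym) eq)

record TwoBlock (n k : ℕ) (P Q : Fin n → Set) : Set where
  field
    class      : Fin n → Fin k
    surjective : Surjective _≡_ _≡_ class
    kernel     : ∀ u v → class u ≡ class v → u ≡ v ⊎ (P u × P v) ⊎ (Q u × Q v)

discrete : ∀ {n} (a p : Fin n) → TwoBlock n n (_≡ a) (_≡ p)
discrete a p = record
  { class = λ u → u ; surjective = λ j → j , λ i≡j → i≡j ; kernel = λ _ _ → inj₁ }

swap : ∀ {n k P Q} → TwoBlock n k P Q → TwoBlock n k Q P
swap {P = P} {Q} T = record { class = class ; surjective = surjective ; kernel = kernel' }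
  where
  open TwoBlock T
  kernel' : ∀ u v → class u ≡ class v → u ≡ v ⊎ (Q u × Q v) ⊎ (P u × P v)
  kernel' u v eq with kernel u v eq
  ... | inj₁ u≡v = inj₁ u≡v
  ... | inj₂ (inj₁ PP) = inj₂ (inj₂ PP)
  ... | inj₂ (inj₂ QQ) = inj₂ (inj₁ QQ)

extend : ∀ {n k P Q} {x y : Fin n} → TwoBlock n (suc k) P Q →
  P x → ¬ Q x → ¬ P y → ¬ Q y → y ≢ x → TwoBlock n k (λ u → P u ⊎ u ≡ y) Q
extend {P = P} {Q} {x} {y} T Px ¬Qx ¬Py ¬Qy y≢x = record
  { class = merge (class x) (class y) cx≢cy ∘ class
  ; surjective = Composition.surjective _≡_ _≡_ _≡_ surjective
                   (merge-surjective (class x) (class y) cx≢cy)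
  ; kernel = kernel'
  }
  where
  open TwoBlock T
  cx≢cy : class x ≢ class y
  cx≢cy eq with kernel x y eq
  ... | inj₁ x≡y = y≢x (sym x≡y)
  ... | inj₂ (inj₁ (_ , Py)) = ¬Py Py
  ... | inj₂ (inj₂ (_ , Qy)) = ¬Qy Qy

  joined : ∀ u → Pair (class x) (class y) (class u) → P u ⊎ u ≡ y
  joined u (inj₁ cu≡cx) with kernel u x cu≡cx
  ... | inj₁ refl = inj₁ Px
  ... | inj₂ (inj₁ (Pu , _)) = inj₁ Pu
  ... | inj₂ (inj₂ (_ , Qx)) = ⊥-elim (¬Qx Qx)
  joined u (inj₂ cu≡cy) with kernel u y cu≡cy
  ... | inj₁ u≡y = inj₂ u≡y
  ... | inj₂ (inj₁ (Pu , _)) = inj₁ Pu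
  ... | inj₂ (inj₂ (_ , Qy)) = ⊥-elim (¬Qy Qy)

  kernel' : ∀ u v → merge (class x) (class y) cx≢cy (class u) ≡ merge (class x) (class y) cx≢cy (class v) →
    u ≡ v ⊎ ((P u ⊎ u ≡ y) × (P v ⊎ v ≡ y)) ⊎ (Q u × Q v)
  kernel' u v eq with merge-kernel (class x) (class y) cx≢cy (class u) (class v) eq
  ... | inj₂ (cu , cv) = inj₂ (inj₁ (joined u cu , joined v cv))
  ... | inj₁ cu≡cv with kernel u v cu≡cv
  ...   | inj₁ u≡v = inj₁ u≡v
  ...   | inj₂ (inj₁ (Pu , Pv)) = inj₂ (inj₁ (inj₁ Pu , inj₁ Pv))
  ...   | inj₂ (inj₂ QQ) = inj₂ (inj₂ QQ)

-- A two-block partition is locating as soon as each block is separated by a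
-- vertex outside both blocks; such a vertex is a singleton class.
twoBlock-locating : ∀ {n k P Q} (G : Graph n) (T : TwoBlock n k P Q) → Connected G →
  ∀ s → ¬ P s → ¬ Q s → (∀ {u v} → P u → P v → u ≢ v → Separates G s u v) →
  ∀ t → ¬ P t → ¬ Q t → (∀ {u v} → Q u → Q v → u ≢ v → Separates G t u v) →
  Locating G (TwoBlock.class T)
twoBlock-locating {P = P} {Q} G T conn s ¬Ps ¬Qs sepP t ¬Pt ¬Qt sepQ =
  locating-criterion G class conn split
  where
  open TwoBlock T
  outside-singleton : ∀ {r} → ¬ P r → ¬ Q r → Singleton G class r
  outside-singleton {r} ¬Pr ¬Qr w eq with kernel w r eq
  ... | inj₁ w≡r = w≡r
  ... | inj₂ (inj₁ (_ , Pr)) = ⊥-elim (¬Pr Pr)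
  ... | inj₂ (inj₂ (_ , Qr)) = ⊥-elim (¬Qr Qr)

  split : ∀ u v → u ≢ v → class u ≡ class v → ∃[ r ] (Singleton G class r × Separates G r u v)
  split u v u≢v eq with kernel u v eq
  ... | inj₁ u≡v = ⊥-elim (u≢v u≡v)
  ... | inj₂ (inj₁ (Pu , Pv)) = s , outside-singleton ¬Ps ¬Qs , sepP Pu Pv u≢v
  ... | inj₂ (inj₂ (Qu , Qv)) = t , outside-singleton ¬Pt ¬Qt , sepQ Qu Qv u≢v

module _ {n : ℕ} (G : Graph n) where

  pair-separated : ∀ {t p q u v} → Separates G t p q →
    Pair p q u → Pair p q v → u ≢ v → Separates G t u v
  pair-separated sep (inj₁ refl) (inj₁ refl) u≢v = ⊥-elim (u≢v refl)
  pair-separated sep (inj₁ refl) (inj₂ refl) _ = sep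
  pair-separated sep (inj₂ refl) (inj₁ refl) _ = separates-sym G sep
  pair-separated sep (inj₂ refl) (inj₂ refl) u≢v = ⊥-elim (u≢v refl)

  triple-separated : ∀ {s a b c u v} →
    Separates G s a b → Separates G s a c → Separates G s b c →
    Triple a b c u → Triple a b c v → u ≢ v → Separates G s u v
  triple-separated ab ac bc (inj₁ u∈ab) (inj₁ v∈ab) = pair-separated ab u∈ab v∈ab
  triple-separated ab ac bc (inj₁ (inj₁ refl)) (inj₂ refl) _ = ac
  triple-separated ab ac bc (inj₁ (inj₂ refl)) (inj₂ refl) _ = bc
  triple-separated ab ac bc (inj₂ refl) (inj₁ (inj₁ refl)) _ = separates-sym G ac
  triple-separated ab ac bc (inj₂ refl) (inj₁ (inj₂ refl)) _ = separates-sym G bc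
  triple-separated ab ac bc (inj₂ refl) (inj₂ refl) u≢v = ⊥-elim (u≢v refl)

record Configuration {n : ℕ} (G : Graph n) : Set where
  field
    a b c p q s t : Fin n
    separates-ab : Separates G s a b
    separates-ac : Separates G s a c
    separates-bc : Separates G s b c
    separates-pq : Separates G t p q
    p∉abc : ¬ Triple a b c p
    q∉abc : ¬ Triple a b c q
    s∉abc : ¬ Triple a b c s
    s∉pq  : ¬ Pair p q s
    t∉abc : ¬ Triple a b c t
    t∉pq  : ¬ Pair p q t

configuration⇒bound : ∀ {k} (G : Graph (suc (suc (suc k)))) → Connected G →
  Configuration G → PartitionDimAtMost G k
configuration⇒bound {k} G conn C =
  k , ≤-refl , TwoBlock.class blocks , TwoBlock.surjective blocks ,
  twoBlock-locating G blocks conn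
    t t∉pq t∉abc (pair-separated G separates-pq)
    s s∉pq s∉abc (triple-separated G separates-ab separates-ac separates-bc)
  where
  open Configuration C
  distinct : ∀ {r u v} → Separates G r u v → u ≢ v
  distinct = separates⇒distinct G conn

  blocks : TwoBlock _ k (Pair p q) (Triple a b c)
  blocks =
    extend
      (swap
        (extend
          (extend (discrete a p) refl (≢-sym (p∉abc ∘ inj₁ ∘ inj₁)) (≢-sym (distinct separates-ab))
                  (≢-sym (p∉abc ∘ inj₁ ∘ inj₂)) (≢-sym (distinct separates-ab)))
          (inj₁ refl) (≢-sym (p∉abc ∘ inj₁ ∘ inj₁))
          (not-pair (≢-sym (distinct separates-ac)) (≢-sym (distinct separates-bc)))
          (≢-sym (p∉abc ∘ inj₂)) (≢-sym (distinct separates-ac))))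
      refl p∉abc (≢-sym (distinct separates-pq)) q∉abc (≢-sym (distinct separates-pq))

record Diametral {n : ℕ} (G : Graph n) (b₀ b₁ b₂ b₃ : Fin n) : Set where
  field
    edge₀₁ : adj G b₀ b₁ ≡ true
    edge₁₂ : adj G b₁ b₂ ≡ true
    edge₂₃ : adj G b₂ b₃ ≡ true
    no-shortcut : ∀ j → j < 3 → ¬ Walk G b₀ b₃ j

  b₀≢b₁ : b₀ ≢ b₁
  b₀≢b₁ refl = no-shortcut 2 (s≤s (s≤s (s≤s z≤n))) (step edge₁₂ (step edge₂₃ here))

  b₀≢b₂ : b₀ ≢ b₂
  b₀≢b₂ refl = no-shortcut 1 (s≤s (s≤s z≤n)) (step edge₂₃ here)

  b₀≢b₃ : b₀ ≢ b₃
  b₀≢b₃ refl = no-shortcut 0 (s≤s z≤n) here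

  b₁≢b₂ : b₁ ≢ b₂
  b₁≢b₂ refl = no-loop G edge₁₂

  b₁≢b₃ : b₁ ≢ b₃
  b₁≢b₃ refl = no-shortcut 1 (s≤s (s≤s z≤n)) (step edge₀₁ here)

  dist₁ : Dist G b₁ b₀ 1
  dist₁ = dist-1 G (≢-sym b₀≢b₁) (adj-flip G edge₀₁)

  dist₂ : Dist G b₂ b₀ 2
  dist₂ = dist-2 G (≢-sym b₀≢b₂)
    (¬-not λ e → no-shortcut 2 (s≤s (s≤s (s≤s z≤n))) (step (adj-flip G e) (step edge₂₃ here)))
    (adj-flip G edge₁₂) (adj-flip G edge₀₁)

  dist₃ : Dist G b₃ b₀ 3
  dist₃ = dist-sym G (step edge₀₁ (step edge₁₂ (step edge₂₃ here)) , no-shortcut)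

diametral-path : ∀ {n} {G : Graph n} {b₀ b₃} → Dist G b₀ b₃ 3 →
  ∃[ b₁ ] ∃[ b₂ ] Diametral G b₀ b₁ b₂ b₃
diametral-path (step {w = b₁} e₀₁ (step {w = b₂} e₁₂ (step e₂₃ here)) , no-shortcut) =
  b₁ , b₂ , record { edge₀₁ = e₀₁ ; edge₁₂ = e₁₂ ; edge₂₃ = e₂₃ ; no-shortcut = no-shortcut }

reverse-diametral : ∀ {n} {G : Graph n} {b₀ b₁ b₂ b₃} →
  Diametral G b₀ b₁ b₂ b₃ → Diametral G b₃ b₂ b₁ b₀
reverse-diametral {G = G} path = record
  { edge₀₁ = adj-flip G edge₂₃ ; edge₁₂ = adj-flip G edge₁₂ ; edge₂₃ = adj-flip G edge₀₁
  ; no-shortcut = λ j j<3 walk → no-shortcut j j<3 (reverse G walk) }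
  where open Diametral path

OffPath : ∀ {n} → Fin n → Fin n → Fin n → Fin n → Fin n → Set
OffPath b₀ b₁ b₂ b₃ x = x ≢ b₀ × x ≢ b₁ × x ≢ b₂ × x ≢ b₃

offPath-reverse : ∀ {n} {b₀ b₁ b₂ b₃ x : Fin n} →
  OffPath b₀ b₁ b₂ b₃ x → OffPath b₃ b₂ b₁ b₀ x
offPath-reverse (x₀ , x₁ , x₂ , x₃) = x₃ , x₂ , x₁ , x₀

module Cases {k : ℕ} (G : Graph (suc (suc (suc k)))) (conn : Connected G)
  {b₀ b₁ b₂ b₃} (path : Diametral G b₀ b₁ b₂ b₃)
  (spare : ∀ x y → ∃[ r ] (OffPath b₀ b₁ b₂ b₃ r × r ≢ x × r ≢ y)) where

  open Diametral path

  Off : Fin (suc (suc (suc k))) → Set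
  Off = OffPath b₀ b₁ b₂ b₃

  Bound : Set
  Bound = PartitionDimAtMost G k

  -- Main case: a vertex t off b₁b₂b₃ separates x and y.  Take the triple
  -- {b₁,b₂,b₃} (distances 1,2,3 to b₀) and the pair {x,y}.
  separated-off-tail : ∀ {x y t} → Off x → Off y →
    t ≢ b₁ → t ≢ b₂ → t ≢ b₃ → t ≢ x → t ≢ y → Separates G t x y → Bound
  separated-off-tail {x} {y} {t} (x₀ , x₁ , x₂ , x₃) (y₀ , y₁ , y₂ , y₃)
    t₁ t₂ t₃ t≢x t≢y sep = configuration⇒bound G conn record
    { a = b₁ ; b = b₂ ; c = b₃ ; p = x ; q = y ; s = b₀ ; t = t
    ; separates-ab = separates-by-distance G dist₁ dist₂ (λ ())
    ; separates-ac = separates-by-distance G dist₁ dist₃ (λ ())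
    ; separates-bc = separates-by-distance G dist₂ dist₃ (λ ())
    ; separates-pq = sep
    ; p∉abc = not-triple x₁ x₂ x₃
    ; q∉abc = not-triple y₁ y₂ y₃
    ; s∉abc = not-triple b₀≢b₁ b₀≢b₂ b₀≢b₃
    ; s∉pq  = not-pair (≢-sym x₀) (≢-sym y₀)
    ; t∉abc = not-triple t₁ t₂ t₃
    ; t∉pq  = not-pair t≢x t≢y
    }

  distinguished-by-b₀ : ∀ {x y} → Off x → Off y → adj G x b₀ ≢ adj G y b₀ → Bound
  distinguished-by-b₀ offx@(x₀ , _) offy@(y₀ , _) different =
    separated-off-tail offx offy b₀≢b₁ b₀≢b₂ b₀≢b₃ (≢-sym x₀) (≢-sym y₀)
      (separates-by-adjacency G x₀ y₀ different)

  -- With a third off-path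
  -- vertex r: if r ~ b₀ take the triple {r,b₂,b₃} (distances 1,2,3 to b₀) and
  -- the pair {x,y} separated by b₁; otherwise b₀ distinguishes x and r.
  near-b₀ : ∀ {x y} → Off x → Off y →
    adj G x b₁ ≡ true → adj G y b₁ ≡ false → adj G x b₀ ≡ true → Bound
  near-b₀ {x} {y} offx@(x₀ , x₁ , x₂ , x₃) offy@(y₀ , y₁ , y₂ , y₃) x~b₁ y≁b₁ x~b₀
    with spare x y
  ... | r , offr@(r₀ , r₁ , _ , _) , r≢x , r≢y with adj G r b₀ in er
  ...   | false = distinguished-by-b₀ offx offr (true≢false-values x~b₀ er)
  ...   | true = configuration⇒bound G conn record
    { a = r ; b = b₂ ; c = b₃ ; p = x ; q = y ; s = b₀ ; t = b₁
    ; separates-ab = separates-by-distance G (dist-1 G r₀ er) dist₂ (λ ())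
    ; separates-ac = separates-by-distance G (dist-1 G r₀ er) dist₃ (λ ())
    ; separates-bc = separates-by-distance G dist₂ dist₃ (λ ())
    ; separates-pq = separates-by-adjacency G x₁ y₁ (true≢false-values x~b₁ y≁b₁)
    ; p∉abc = not-triple (≢-sym r≢x) x₂ x₃
    ; q∉abc = not-triple (≢-sym r≢y) y₂ y₃
    ; s∉abc = not-triple (≢-sym r₀) b₀≢b₂ b₀≢b₃
    ; s∉pq  = not-pair (≢-sym x₀) (≢-sym y₀)
    ; t∉abc = not-triple (≢-sym r₁) b₁≢b₂ b₁≢b₃
    ; t∉pq  = not-pair (≢-sym x₁) (≢-sym y₁)
    }

  -- b₁ distinguishes x ~ b₁ from y ≁ b₁, and neither is adjacent to b₀, so
  -- d(x,b₀) = 2.  A common neighbour w of y and b₀ lies off the path and is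
  -- distinguished from y by b₀; without one, d(y,b₀) ≠ 2 and b₀ separates x, y.
  far-from-b₀ : ∀ {x y} → Off x → Off y →
    adj G x b₁ ≡ true → adj G y b₁ ≡ false → adj G x b₀ ≡ false → adj G y b₀ ≡ false → Bound
  far-from-b₀ {x} {y} offx@(x₀ , _) offy@(y₀ , _) x~b₁ y≁b₁ x≁b₀ y≁b₀
    with any? (λ w → (adj G y w ≟ᵇ true) ×-dec (adj G w b₀ ≟ᵇ true))
  ... | yes (w , y~w , w~b₀) = distinguished-by-b₀ offw offy (true≢false-values w~b₀ y≁b₀)
    where
    offw : Off w
    offw = (λ { refl → no-loop G w~b₀ })
         , (λ { refl → true≢false-values y~w y≁b₁ refl })
         , (λ { refl → far⇒nonadjacent G dist₂ w~b₀ })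
         , (λ { refl → far⇒nonadjacent G dist₃ w~b₀ })
  ... | no no-common = separated-off-tail offx offy b₀≢b₁ b₀≢b₂ b₀≢b₃ (≢-sym x₀) (≢-sym y₀) sep
    where
    x-at-2 : Dist G x b₀ 2
    x-at-2 = dist-2 G x₀ x≁b₀ x~b₁ (adj-flip G edge₀₁)

    sep : Separates G b₀ x y
    sep Dx (walk , _) d≡d' with dist-unique G Dx x-at-2
    ... | refl with d≡d'
    ...   | refl = no-common (walk-2 G walk)

  one-side-of-b₁ : ∀ {x y} → Off x → Off y →
    adj G x b₁ ≡ true → adj G y b₁ ≡ false → adj G x b₀ ≡ adj G y b₀ → Bound
  one-side-of-b₁ {x} offx offy x~b₁ y≁b₁ same with adj G x b₀ in ex₀
  ... | true  = near-b₀ offx offy x~b₁ y≁b₁ ex₀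
  ... | false = far-from-b₀ offx offy x~b₁ y≁b₁ ex₀ (sym same)

  distinguished-by-b₁ : ∀ {x y} → Off x → Off y → adj G x b₁ ≢ adj G y b₁ → Bound
  distinguished-by-b₁ {x} {y} offx offy different with adj G x b₀ ≟ᵇ adj G y b₀
  ... | no different₀ = distinguished-by-b₀ offx offy different₀
  ... | yes same with adj G x b₁ in ex | adj G y b₁ in ey
  ...   | true  | true  = ⊥-elim (different refl)
  ...   | false | false = ⊥-elim (different refl)
  ...   | true  | false = one-side-of-b₁ offx offy ex ey same
  ...   | false | true  = one-side-of-b₁ offy offx ey ex (sym same)

spare-reverse : ∀ {n} {b₀ b₁ b₂ b₃ : Fin n} →
  (∀ x y → ∃[ r ] (OffPath b₀ b₁ b₂ b₃ r × r ≢ x × r ≢ y)) →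
  (∀ x y → ∃[ r ] (OffPath b₃ b₂ b₁ b₀ r × r ≢ x × r ≢ y))
spare-reverse spare x y with spare x y
... | r , offr , r≢x , r≢y = r , offPath-reverse offr , r≢x , r≢y

-- If some vertex z is adjacent to exactly one of two off-path vertices x, y,
-- the bound holds: z = b₁ or z = b₂ is the case of b₁ for the path or its
-- reverse, z = b₃ is b₀ of the reversed path, otherwise z separates x and y.
non-twins⇒bound : ∀ {k} (G : Graph (suc (suc (suc k)))) → Connected G →
  ∀ {b₀ b₁ b₂ b₃} → Diametral G b₀ b₁ b₂ b₃ →
  (∀ x y → ∃[ r ] (OffPath b₀ b₁ b₂ b₃ r × r ≢ x × r ≢ y)) →
  ∀ {x y z} → OffPath b₀ b₁ b₂ b₃ x → OffPath b₀ b₁ b₂ b₃ y →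
  z ≢ x → z ≢ y → adj G x z ≢ adj G y z → PartitionDimAtMost G k
non-twins⇒bound G conn {b₁ = b₁} {b₂} {b₃} path spare {z = z} offx offy z≢x z≢y different
  with z ≟ b₁ | z ≟ b₂ | z ≟ b₃
... | yes refl | _ | _ = Cases.distinguished-by-b₁ G conn path spare offx offy different
... | no _ | yes refl | _ =
  Cases.distinguished-by-b₁ G conn (reverse-diametral path) (spare-reverse spare)
    (offPath-reverse offx) (offPath-reverse offy) different
... | no _ | no _ | yes refl =
  Cases.distinguished-by-b₀ G conn (reverse-diametral path) (spare-reverse spare)
    (offPath-reverse offx) (offPath-reverse offy) different
... | no z≢b₁ | no z≢b₂ | no z≢b₃ =
  Cases.separated-off-tail G conn path spare offx offy z≢b₁ z≢b₂ z≢b₃ z≢x z≢y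
    (separates-by-adjacency G (≢-sym z≢x) (≢-sym z≢y) different)

remove : ∀ {m} → Fin m → Subset m → Subset m
remove zero (_ ∷ p) = outside ∷ p
remove (suc x) (b ∷ p) = b ∷ remove x p

remove-size : ∀ {m} (x : Fin m) (p : Subset m) → ∣ p ∣ ≤ suc ∣ remove x p ∣
remove-size zero (inside ∷ p) = ≤-refl
remove-size zero (outside ∷ p) = n≤1+n _
remove-size (suc x) (inside ∷ p) = s≤s (remove-size x p)
remove-size (suc x) (outside ∷ p) = remove-size x p

remove-∈ : ∀ {m} {x v : Fin m} {p : Subset m} → v ∈ remove x p → v ≢ x × v ∈ p
remove-∈ {x = zero} {zero} {_ ∷ p} ()
remove-∈ {x = zero} {suc v} {_ ∷ p} (there v∈p) = (λ ()) , there v∈p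
remove-∈ {x = suc x} {zero} {_ ∷ p} here = (λ ()) , here
remove-∈ {x = suc x} {suc v} {_ ∷ p} (there v∈p) with remove-∈ v∈p
... | v≢x , v∈p′ = (λ sv≡sx → v≢x (suc-injective sv≡sx)) , there v∈p′

positive⇒nonempty : ∀ {m} (p : Subset m) → 0 < ∣ p ∣ → Nonempty p
positive⇒nonempty {m} p 0<∣p∣ with nonempty? p
... | yes nonempty = nonempty
... | no empty with subst (0 <_) (trans (cong ∣_∣ (Empty-unique empty)) (∣⊥∣≡0 m)) 0<∣p∣
...   | ()

spare-element : ∀ {m} (R : Subset m) → 3 ≤ ∣ R ∣ → ∀ x y → ∃[ r ] (r ∈ R × r ≢ x × r ≢ y)
spare-element R 3≤∣R∣ x y
  with positive⇒nonempty (remove y (remove x R))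
         (+-cancelˡ-≤ 2 1 _ (≤-trans 3≤∣R∣ (≤-trans (remove-size x R) (s≤s (remove-size y _)))))
... | r , r∈R-x-y with remove-∈ r∈R-x-y
... | r≢y , r∈R-x with remove-∈ r∈R-x
... | r≢x , r∈R = r , r∈R , r≢x , r≢y

off-path-set : ∀ {n} (b₀ b₁ b₂ b₃ : Fin n) →
  Σ[ R ∈ Subset n ] ((∀ {x} → x ∈ R → OffPath b₀ b₁ b₂ b₃ x) × n ≤ 4 + ∣ R ∣)
off-path-set {n} b₀ b₁ b₂ b₃ = R₃ , off , size
  where
  R₀ R₁ R₂ R₃ : Subset n
  R₀ = remove b₀ (⊤ {n})
  R₁ = remove b₁ R₀
  R₂ = remove b₂ R₁
  R₃ = remove b₃ R₂

  off : ∀ {x} → x ∈ R₃ → OffPath b₀ b₁ b₂ b₃ x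
  off x∈R₃ with remove-∈ x∈R₃
  ... | x₃ , x∈R₂ with remove-∈ x∈R₂
  ... | x₂ , x∈R₁ with remove-∈ x∈R₁
  ... | x₁ , x∈R₀ with remove-∈ {p = ⊤} x∈R₀
  ... | x₀ , _ = x₀ , x₁ , x₂ , x₃

  size : n ≤ 4 + ∣ R₃ ∣
  size = begin
    n              ≡⟨ sym (∣⊤∣≡n n) ⟩
    ∣ ⊤ {n} ∣      ≤⟨ remove-size b₀ ⊤ ⟩
    1 + ∣ R₀ ∣     ≤⟨ s≤s (remove-size b₁ R₀) ⟩
    2 + ∣ R₁ ∣     ≤⟨ s≤s (s≤s (remove-size b₂ R₁)) ⟩
    3 + ∣ R₂ ∣     ≤⟨ s≤s (s≤s (s≤s (remove-size b₃ R₂))) ⟩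
    4 + ∣ R₃ ∣     ∎
    where open ≤-Reasoning

large-remainder : ∀ {n r} → 9 ≤ n → n ≤ 4 + r → 3 ≤ r × n < r + r
large-remainder {n} {r} 9≤n n≤4+r =
  ≤-trans (s≤s (s≤s (s≤s z≤n))) 5≤r , ≤-trans (s≤s n≤4+r) (+-monoˡ-≤ r 5≤r)
  where
  5≤r : 5 ≤ r
  5≤r = +-cancelˡ-≤ 4 5 r (≤-trans 9≤n n≤4+r)

non-twin-pair : ∀ {n} (G : Graph n) → TwinBound G → (R : Subset n) → n < ∣ R ∣ + ∣ R ∣ →
  ∃[ x ] ∃[ y ] ∃[ z ] (x ∈ R × y ∈ R × z ≢ x × z ≢ y × adj G x z ≢ adj G y z)
non-twin-pair G twinBound R large
  with any? (λ x → any? (λ y → any? (λ z → (x ∈? R) ×-dec (y ∈? R) ×-dec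
         ¬? (z ≟ x) ×-dec ¬? (z ≟ y) ×-dec ¬? (adj G x z ≟ᵇ adj G y z))))
... | yes witness = witness
... | no none = ⊥-elim (<⇒≱ large (twinBound R twins))
  where
  twins : ∀ u v → u ∈ R → v ∈ R → Twins G u v
  twins u v u∈R v∈R w w≢u w≢v with adj G u w ≟ᵇ adj G v w
  ... | yes same = same
  ... | no different = ⊥-elim (none (u , v , w , u∈R , v∈R , w≢u , w≢v , different))

mainTheorem6 : (n : ℕ) (G : Graph n) → 9 ≤ n → Connected G →
    TwinBound G → Diameter≡3 G → PartitionDimAtMost G (n ∸ 3)
mainTheorem6 _ G 9≤n@(s≤s (s≤s (s≤s _))) conn twinBound (_ , b₀ , b₃ , d₀₃)
  with diametral-path d₀₃
... | b₁ , b₂ , path with off-path-set b₀ b₁ b₂ b₃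
... | R , off , size with large-remainder 9≤n size
... | 3≤∣R∣ , more-than-half with non-twin-pair G twinBound R more-than-half
... | x , y , z , x∈R , y∈R , z≢x , z≢y , different =
  non-twins⇒bound G conn path spare (off x∈R) (off y∈R) z≢x z≢y different
  where
  spare : ∀ u v → ∃[ r ] (OffPath b₀ b₁ b₂ b₃ r × r ≢ u × r ≢ v)
  spare u v with spare-element R 3≤∣R∣ u v
  ... | r , r∈R , r≢u , r≢v = r , off r∈R , r≢u , r≢v
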